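{- Let $n\ge 1$ and let $N$ be an integer with $2^n-1\le N\le 2^{n+1}-2$. In unlabeled chip-firing on the infinite binary tree with a self-loop at the root, starting with $N$ chips at the root, the (unique) terminal configuration has the following property: the set of nodes containing at least one chip is exactly the set of nodes on levels $1,\dots,n$ (so these nodes form a perfect binary tree of height $n$), and any two nodes on the same level contain the same number of chips.
   Context: The infinite binary tree has nodes labeled by positive integers: node $1$ is the root, node $i$ has children $2i$ and $2i+1$ and (for $i>1$) parent $\lfloor i/2\rfloor$. A self-loop is added at the root, so every node has degree $3$. The level of node $i$ is $\lfloor\log_2 i\rfloor+1$. Unlabeled chip-firing: a configuration assigns a nonnegative number of indistinguishable chips to each node; a node with at least $3$ chips may fire, sending one chip to each of its two children and one chip to its parent (the root sends this chip to itself). A configuration is terminal (stable) if no node has $3$ or more chips; the process starting from finitely many chips always terminates in a unique terminal configuration. -}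

module Defs where

open import Data.Nat using (ℕ; zero; suc; _+_; _*_; _∸_; _^_; _≤_; _<_; ⌊_/2⌋)
open import Data.Nat.Logarithm using (⌊log₂_⌋)
open import Data.Bool using (Bool; true; false; if_then_else_)
open import Data.Nat using (_≡ᵇ_)
open import Data.Product using (Σ; _×_; ∃)
open import Relation.Binary.PropositionalEquality using (_≡_)
open import Relation.Binary.Construct.Closure.ReflexiveTransitive using (Star)

-- A configuration assigns a number of chips to each natural number;
-- nodes are the positive integers, index 0 is a dummy (never touched).
Config : Set
Config = ℕ → ℕ

parent : ℕ → ℕ
parent 1 = 1
parent n = ⌊ n /2⌋

level : ℕ → ℕ
level i = suc ⌊log₂ i ⌋

ind : ℕ → ℕ → ℕ
ind a b = if a ≡ᵇ b then 1 else 0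

-- result of firing node i: i loses 3 chips, its children 2i, 2i+1
-- and its parent (itself, if i = 1) gain one chip each
fire : ℕ → Config → Config
fire i c j =
  (c j + ind j (2 * i) + ind j (2 * i + 1) + ind j (parent i)) ∸ (3 * ind j i)

Step : Config → Config → Set
Step c c' = Σ ℕ λ i → (1 ≤ i) × (3 ≤ c i) × (∀ j → c' j ≡ fire i c j)

Reachable : Config → Config → Set
Reachable = Star Step

Terminal : Config → Set
Terminal c = ∀ i → 1 ≤ i → c i < 3

initial : ℕ → Config
initial N j = if j ≡ᵇ 1 then N else 0

-- A node of depth l of the terminal configuration holds R l − 2 R (l + 1) chips, where
-- R l = ⌊(N + 1) / 2 ^ l⌋ − 1 counts the chips ending in its subtree; this is 1 or 2 above
-- depth n and 0 from depth n on. Firing counts are bounded through chip conservation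
-- c + 3 u = c₀ + (u summed over the three neighbours), and this level profile has an explicit
-- solution U, constant on levels. By the least action principle every legal firing sequence
-- stays below U. The excess U − u of a terminal configuration c vanishes from depth n on and,
-- since c is stable and the profile is positive above depth n, a positive excess would have to
-- grow strictly towards the root, which the self-loop at the root forbids. So the excess is 0
-- and c is the profile.
module Submission where

open import Defs
open import Data.Nat
open import Data.Nat.Properties
open import Data.Nat.Logarithm
open import Data.Nat.Tactic.RingSolver using (solve-∀)
open import Algebra.Properties.CommutativeSemigroup +-commutativeSemigroup using (x∙yz≈xz∙y; xy∙z≈xz∙y)
open import Data.Product using (∃; _×_; _,_; proj₁)
open import Data.Sum using (_⊎_; inj₁; inj₂)
open import Data.Empty using (⊥-elim)
open import Function using (_∘_)
open import Function.Definitions using (Injective)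
open import Relation.Nullary using (yes; no)
open import Relation.Binary.PropositionalEquality
open import Relation.Binary.Construct.Closure.ReflexiveTransitive using (ε; _◅_)

-- Halving and logarithms

⌊2*n/2⌋≡n : ∀ n → ⌊ 2 * n /2⌋ ≡ n
⌊2*n/2⌋≡n n = trans (cong (λ m → ⌊ n + m /2⌋) (+-identityʳ n)) (sym (n≡⌊n+n/2⌋ n))

⌊2*n+1/2⌋≡n : ∀ n → ⌊ 2 * n + 1 /2⌋ ≡ n
⌊2*n+1/2⌋≡n n = trans (cong ⌊_/2⌋ (+-comm (2 * n) 1)) (⌊1+2*n/2⌋≡n n)
  where
  ⌊1+2*n/2⌋≡n : ∀ n → ⌊ suc (2 * n) /2⌋ ≡ n
  ⌊1+2*n/2⌋≡n zero    = refl
  ⌊1+2*n/2⌋≡n (suc n) = trans (cong (λ m → ⌊ suc m /2⌋) (*-suc 2 n)) (cong suc (⌊1+2*n/2⌋≡n n))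

even⊎odd : ∀ n → n ≡ 2 * ⌊ n /2⌋ ⊎ n ≡ 2 * ⌊ n /2⌋ + 1
even⊎odd zero          = inj₁ refl
even⊎odd (suc zero)    = inj₂ refl
even⊎odd (suc (suc n)) with even⊎odd n
... | inj₁ e = inj₁ (trans (cong (2 +_) e) (sym (*-suc 2 ⌊ n /2⌋)))
... | inj₂ e = inj₂ (trans (cong (2 +_) e) (cong (_+ 1) (sym (*-suc 2 ⌊ n /2⌋))))

2*⌊n/2⌋≤n : ∀ n → 2 * ⌊ n /2⌋ ≤ n
2*⌊n/2⌋≤n n with even⊎odd n
... | inj₁ e = ≤-reflexive (sym e)
... | inj₂ e = ≤-trans (m≤m+n _ 1) (≤-reflexive (sym e))

n∸2*⌊n/2⌋≤1 : ∀ n → n ∸ 2 * ⌊ n /2⌋ ≤ 1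
n∸2*⌊n/2⌋≤1 n = m≤n+o⇒m∸n≤o n (2 * ⌊ n /2⌋) n≤2*⌊n/2⌋+1
  where
  n≤2*⌊n/2⌋+1 : n ≤ 2 * ⌊ n /2⌋ + 1
  n≤2*⌊n/2⌋+1 with even⊎odd n
  ... | inj₁ e = ≤-trans (≤-reflexive e) (m≤m+n _ 1)
  ... | inj₂ e = ≤-reflexive e

*2-injective : Injective _≡_ _≡_ (2 *_)
*2-injective {x} {y} = *-cancelˡ-≡ x y 2

*2+1-injective : Injective _≡_ _≡_ (λ n → 2 * n + 1)
*2+1-injective {x} {y} = *2-injective ∘ +-cancelʳ-≡ 1 (2 * x) (2 * y)

2≤2*n : ∀ {n} → 1 ≤ n → 2 ≤ 2 * n
2≤2*n = *-monoʳ-≤ 2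

⌊log₂⌋-positive : ∀ {x} → 2 ≤ x → 1 ≤ ⌊log₂ x ⌋
⌊log₂⌋-positive {x} 2≤x = subst (_≤ ⌊log₂ x ⌋) (⌊log₂[2^n]⌋≡n 1) (⌊log₂⌋-mono-≤ 2≤x)

⌊log₂⌋-positive⁻¹ : ∀ {x} → 1 ≤ ⌊log₂ x ⌋ → 2 ≤ x
⌊log₂⌋-positive⁻¹ {suc (suc _)} _ = s≤s (s≤s z≤n)

⌊log₂⌋-<2^ : ∀ k {x} → x < 2 ^ suc k → ⌊log₂ x ⌋ ≤ k
⌊log₂⌋-<2^ zero    {zero}        _ = z≤n
⌊log₂⌋-<2^ zero    {suc zero}    _ = z≤n
⌊log₂⌋-<2^ zero    {suc (suc _)} (s≤s (s≤s ()))
⌊log₂⌋-<2^ (suc k) {x}           x<2^k+2 = begin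
  ⌊log₂ x ⌋                 ≤⟨ m≤n+m∸n ⌊log₂ x ⌋ 1 ⟩
  suc (⌊log₂ x ⌋ ∸ 1)       ≡⟨ cong suc (⌊log₂⌊n/2⌋⌋≡⌊log₂n⌋∸1 x) ⟨
  suc ⌊log₂ ⌊ x /2⌋ ⌋       ≤⟨ s≤s (⌊log₂⌋-<2^ k (*-cancelˡ-< 2 ⌊ x /2⌋ (2 ^ suc k) (≤-<-trans (2*⌊n/2⌋≤n x) x<2^k+2))) ⟩
  suc k                     ∎
  where open ≤-Reasoning

⌊log₂⌋-between : ∀ k {x} → 2 ^ k ≤ x → x < 2 ^ suc k → ⌊log₂ x ⌋ ≡ k
⌊log₂⌋-between k 2^k≤x x<2^k+1 =
  ≤-antisym (⌊log₂⌋-<2^ k x<2^k+1) (subst (_≤ _) (⌊log₂[2^n]⌋≡n k) (⌊log₂⌋-mono-≤ 2^k≤x))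

-- Adjacency in the tree

ind-refl : ∀ a → ind a a ≡ 1
ind-refl zero    = refl
ind-refl (suc a) = ind-refl a

ind-≢ : ∀ {a b} → a ≢ b → ind a b ≡ 0
ind-≢ {zero}  {zero}  a≢b = ⊥-elim (a≢b refl)
ind-≢ {zero}  {suc b} _   = refl
ind-≢ {suc a} {zero}  _   = refl
ind-≢ {suc a} {suc b} a≢b = ind-≢ (a≢b ∘ cong suc)

ind-sym : ∀ a b → ind a b ≡ ind b a
ind-sym a b with a ≟ b
... | yes refl = refl
... | no a≢b   = trans (ind-≢ a≢b) (sym (ind-≢ (a≢b ∘ sym)))

ind-injective : ∀ {f : ℕ → ℕ} → Injective _≡_ _≡_ f → ∀ a b → ind (f a) (f b) ≡ ind a b
ind-injective {f} f-inj a b with a ≟ b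
... | yes refl = trans (ind-refl (f a)) (sym (ind-refl a))
... | no a≢b   = trans (ind-≢ (λ e → a≢b (f-inj e))) (sym (ind-≢ a≢b))

ind-even-odd : ∀ m n → ind (2 * m) (2 * n + 1) ≡ 0
ind-even-odd m n = ind-≢ (λ e → even≢odd m n (trans e (+-comm (2 * n) 1)))

ind-odd-even : ∀ m n → ind (2 * m + 1) (2 * n) ≡ 0
ind-odd-even m n = trans (ind-sym (2 * m + 1) (2 * n)) (ind-even-odd n m)

parent-nonroot : ∀ {j} → 2 ≤ j → parent j ≡ ⌊ j /2⌋
parent-nonroot (s≤s (s≤s _)) = refl

parent-left : ∀ {i} → 1 ≤ i → parent (2 * i) ≡ i
parent-left {i} i≥1 = trans (parent-nonroot (2≤2*n i≥1)) (⌊2*n/2⌋≡n i)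

parent-right : ∀ {i} → 1 ≤ i → parent (2 * i + 1) ≡ i
parent-right {i} i≥1 = trans (parent-nonroot (m≤n⇒m≤n+o 1 (2≤2*n i≥1))) (⌊2*n+1/2⌋≡n i)

parent-positive : ∀ {j} → 1 ≤ j → 1 ≤ parent j
parent-positive {suc zero}    _ = s≤s z≤n
parent-positive {suc (suc _)} _ = s≤s z≤n

left-positive : ∀ {i} → 1 ≤ i → 1 ≤ 2 * i
left-positive i≥1 = <⇒≤ (2≤2*n i≥1)

right-positive : ∀ {i} → 1 ≤ i → 1 ≤ 2 * i + 1
right-positive i≥1 = m≤n⇒m≤n+o 1 (left-positive i≥1)

depth-parent : ∀ {j} → 2 ≤ j → ⌊log₂ j ⌋ ≡ suc ⌊log₂ parent j ⌋
depth-parent {j} j≥2 = begin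
  ⌊log₂ j ⌋                 ≡⟨ m+[n∸m]≡n (⌊log₂⌋-positive j≥2) ⟨
  suc (⌊log₂ j ⌋ ∸ 1)       ≡⟨ cong suc (⌊log₂⌊n/2⌋⌋≡⌊log₂n⌋∸1 j) ⟨
  suc ⌊log₂ ⌊ j /2⌋ ⌋       ≡⟨ cong (suc ∘ ⌊log₂_⌋) (parent-nonroot j≥2) ⟨
  suc ⌊log₂ parent j ⌋      ∎
  where open ≡-Reasoning

depth-left : ∀ {i} → 1 ≤ i → ⌊log₂ 2 * i ⌋ ≡ suc ⌊log₂ i ⌋
depth-left i≥1 = trans (depth-parent (2≤2*n i≥1)) (cong (suc ∘ ⌊log₂_⌋) (parent-left i≥1))

depth-right : ∀ {i} → 1 ≤ i → ⌊log₂ 2 * i + 1 ⌋ ≡ suc ⌊log₂ i ⌋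
depth-right i≥1 = trans (depth-parent (m≤n⇒m≤n+o 1 (2≤2*n i≥1))) (cong (suc ∘ ⌊log₂_⌋) (parent-right i≥1))

ind-children : ∀ {j} p i → j ≡ 2 * p ⊎ j ≡ 2 * p + 1 → ind p i ≡ ind j (2 * i) + ind j (2 * i + 1)
ind-children p i (inj₁ refl) = begin
  ind p i                                          ≡⟨ sym (ind-injective *2-injective p i) ⟩
  ind (2 * p) (2 * i)                              ≡⟨ sym (+-identityʳ _) ⟩
  ind (2 * p) (2 * i) + 0                          ≡⟨ cong (ind (2 * p) (2 * i) +_) (sym (ind-even-odd p i)) ⟩
  ind (2 * p) (2 * i) + ind (2 * p) (2 * i + 1)    ∎
  where open ≡-Reasoning
ind-children p i (inj₂ refl) = begin
  ind p i                                                ≡⟨ sym (ind-injective *2+1-injective p i) ⟩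
  0 + ind (2 * p + 1) (2 * i + 1)                        ≡⟨ cong (_+ ind (2 * p + 1) (2 * i + 1)) (sym (ind-odd-even p i)) ⟩
  ind (2 * p + 1) (2 * i) + ind (2 * p + 1) (2 * i + 1)  ∎
  where open ≡-Reasoning

-- The root is its own parent through the self-loop; that is the last summand.
parent-ind : ∀ {i j} → 1 ≤ i → 1 ≤ j → ind (parent j) i ≡ ind j (2 * i) + ind j (2 * i + 1) + ind j 1 * ind i 1
parent-ind {i} {suc zero} i≥1 _
  rewrite ind-≢ {1} {2 * i} (<⇒≢ (2≤2*n i≥1))
        | ind-≢ {1} {2 * i + 1} (<⇒≢ (m≤n⇒m≤n+o 1 (2≤2*n i≥1)))
        = trans (ind-sym 1 i) (sym (+-identityʳ (ind i 1)))
parent-ind {i} {j@(suc (suc _))} _ _ = begin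
  ind ⌊ j /2⌋ i                            ≡⟨ ind-children ⌊ j /2⌋ i (even⊎odd j) ⟩
  ind j (2 * i) + ind j (2 * i + 1)        ≡⟨ sym (+-identityʳ _) ⟩
  ind j (2 * i) + ind j (2 * i + 1) + 0    ∎
  where open ≡-Reasoning

-- Odometers and the least action principle

inflow : (ℕ → ℕ) → ℕ → ℕ
inflow v j = v (parent j) + v (2 * j) + v (2 * j + 1)

inflow-+ : ∀ v w j → inflow (λ x → v x + w x) j ≡ inflow v j + inflow w j
inflow-+ v w j = shuffle (v (parent j)) (v (2 * j)) (v (2 * j + 1)) (w (parent j)) (w (2 * j)) (w (2 * j + 1))
  where
  shuffle : ∀ p l r p′ l′ r′ → (p + p′) + (l + l′) + (r + r′) ≡ (p + l + r) + (p′ + l′ + r′)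
  shuffle = solve-∀

inflow-mono : ∀ {v w} → (∀ x → v x ≤ w x) → ∀ j → inflow v j ≤ inflow w j
inflow-mono v≤w j = +-mono-≤ (+-mono-≤ (v≤w _) (v≤w _)) (v≤w _)

-- Symmetry of the adjacency relation, the root loop included.
fire-delivers : ∀ {i j} → 1 ≤ i → 1 ≤ j →
  ind j (2 * i) + ind j (2 * i + 1) + ind j (parent i) ≡ inflow (λ x → ind x i) j
fire-delivers {i} {j} i≥1 j≥1 = begin
  ind j (2 * i) + ind j (2 * i + 1) + ind j (parent i)
    ≡⟨ cong (ind j (2 * i) + ind j (2 * i + 1) +_) (trans (ind-sym j (parent i)) (parent-ind j≥1 i≥1)) ⟩
  ind j (2 * i) + ind j (2 * i + 1) + (ind i (2 * j) + ind i (2 * j + 1) + ind i 1 * ind j 1)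
    ≡⟨ regroup (ind j (2 * i)) (ind j (2 * i + 1)) (ind i (2 * j)) (ind i (2 * j + 1)) (ind i 1) (ind j 1) ⟩
  ind j (2 * i) + ind j (2 * i + 1) + ind j 1 * ind i 1 + ind i (2 * j) + ind i (2 * j + 1)
    ≡⟨ cong₂ (λ x y → x + y + ind i (2 * j + 1)) (sym (parent-ind i≥1 j≥1)) (ind-sym i (2 * j)) ⟩
  ind (parent j) i + ind (2 * j) i + ind i (2 * j + 1)
    ≡⟨ cong (ind (parent j) i + ind (2 * j) i +_) (ind-sym i (2 * j + 1)) ⟩
  inflow (λ x → ind x i) j ∎
  where
  open ≡-Reasoning
  regroup : ∀ a b c d x y → a + b + (c + d + x * y) ≡ a + b + y * x + c + d
  regroup = solve-∀

fire-balance : ∀ {i} (c : Config) j → 3 ≤ c i →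
  fire i c j + 3 * ind j i ≡ c j + ind j (2 * i) + ind j (2 * i + 1) + ind j (parent i)
fire-balance {i} c j 3≤ci with j ≟ i
... | yes refl rewrite ind-refl j = m∸n+n≡m (≤-trans 3≤ci (≤-trans (m≤m+n (c j) _) (≤-trans (m≤m+n _ _) (m≤m+n _ _))))
... | no j≢i   rewrite ind-≢ j≢i  = +-identityʳ _

-- Chip conservation at every node: it holds when v x counts the firings of x in a legal sequence from c₀ to c.
Odometer : Config → Config → (ℕ → ℕ) → Set
Odometer c₀ c v = ∀ j → 1 ≤ j → c j + 3 * v j ≡ c₀ j + inflow v j

odometer-refl : ∀ c → Odometer c c (λ _ → 0)
odometer-refl c j _ = refl

odometer-step : ∀ {c₀ c c′ v} → Odometer c₀ c v → (s : Step c c′) → Odometer c₀ c′ (λ x → v x + ind x (proj₁ s))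
odometer-step {c₀} {c} {c′} {v} odo (i , i≥1 , 3≤ci , c′≡fire) j j≥1 = begin
  c′ j + 3 * (v j + ind j i)
    ≡⟨ cong (λ x → x + 3 * (v j + ind j i)) (c′≡fire j) ⟩
  fire i c j + 3 * (v j + ind j i)
    ≡⟨ split (fire i c j) (v j) (ind j i) ⟩
  (fire i c j + 3 * ind j i) + 3 * v j
    ≡⟨ cong (_+ 3 * v j) (fire-balance c j 3≤ci) ⟩
  c j + ind j (2 * i) + ind j (2 * i + 1) + ind j (parent i) + 3 * v j
    ≡⟨ regroup (c j) (ind j (2 * i)) (ind j (2 * i + 1)) (ind j (parent i)) (v j) ⟩
  (c j + 3 * v j) + (ind j (2 * i) + ind j (2 * i + 1) + ind j (parent i))
    ≡⟨ cong₂ _+_ (odo j j≥1) (fire-delivers i≥1 j≥1) ⟩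
  (c₀ j + inflow v j) + inflow (λ x → ind x i) j
    ≡⟨ +-assoc (c₀ j) (inflow v j) _ ⟩
  c₀ j + (inflow v j + inflow (λ x → ind x i) j)
    ≡⟨ cong (c₀ j +_) (sym (inflow-+ v (λ x → ind x i) j)) ⟩
  c₀ j + inflow (λ x → v x + ind x i) j ∎
  where
  open ≡-Reasoning
  split : ∀ f v d → f + 3 * (v + d) ≡ (f + 3 * d) + 3 * v
  split = solve-∀
  regroup : ∀ c a b d v → c + a + b + d + 3 * v ≡ (c + 3 * v) + (a + b + d)
  regroup = solve-∀

odometer-difference : ∀ {c₀ c t u U} → Odometer c₀ c u → Odometer c₀ t U → (∀ x → u x ≤ U x) →
  Odometer c t (λ x → U x ∸ u x)
odometer-difference {c₀} {c} {t} {u} {U} odo odoU u≤U j j≥1 = +-cancelʳ-≡ (3 * u j) _ _ (begin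
  t j + 3 * w j + 3 * u j           ≡⟨ distrib (t j) (w j) (u j) ⟩
  t j + 3 * (w j + u j)             ≡⟨ cong (λ x → t j + 3 * x) (w+u≡U j) ⟩
  t j + 3 * U j                     ≡⟨ odoU j j≥1 ⟩
  c₀ j + inflow U j                 ≡⟨ cong (c₀ j +_) (inflow-cong (λ x → sym (w+u≡U x))) ⟩
  c₀ j + inflow (λ x → w x + u x) j ≡⟨ cong (c₀ j +_) (inflow-+ w u j) ⟩
  c₀ j + (inflow w j + inflow u j)  ≡⟨ x∙yz≈xz∙y (c₀ j) (inflow w j) (inflow u j) ⟩
  (c₀ j + inflow u j) + inflow w j  ≡⟨ cong (_+ inflow w j) (odo j j≥1) ⟨
  (c j + 3 * u j) + inflow w j      ≡⟨ xy∙z≈xz∙y (c j) (3 * u j) (inflow w j) ⟩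
  c j + inflow w j + 3 * u j        ∎)
  where
  open ≡-Reasoning
  w : ℕ → ℕ
  w x = U x ∸ u x
  w+u≡U : ∀ x → w x + u x ≡ U x
  w+u≡U x = m∸n+n≡m (u≤U x)
  inflow-cong : ∀ {v v′} → (∀ x → v x ≡ v′ x) → inflow v j ≡ inflow v′ j
  inflow-cong v≡v′ = cong₂ _+_ (cong₂ _+_ (v≡v′ _) (v≡v′ _)) (v≡v′ _)
  distrib : ∀ t w u → t + 3 * w + 3 * u ≡ t + 3 * (w + u)
  distrib = solve-∀

odometer-zero : ∀ {c₀ c w} → Odometer c₀ c w → (∀ j → 1 ≤ j → w j ≡ 0) → ∀ j → 1 ≤ j → c j ≡ c₀ j
odometer-zero {c₀} {c} {w} odo w≡0 j j≥1 = +-cancelʳ-≡ 0 (c j) (c₀ j) (begin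
  c j + 0            ≡⟨ cong (λ x → c j + 3 * x) (w≡0 j j≥1) ⟨
  c j + 3 * w j      ≡⟨ odo j j≥1 ⟩
  c₀ j + inflow w j  ≡⟨ cong (c₀ j +_) inflow≡0 ⟩
  c₀ j + 0           ∎)
  where
  open ≡-Reasoning
  inflow≡0 : inflow w j ≡ 0
  inflow≡0 rewrite w≡0 (parent j) (parent-positive j≥1)
                 | w≡0 (2 * j) (left-positive j≥1)
                 | w≡0 (2 * j + 1) (right-positive j≥1) = refl

module _ {c₀ t : Config} {U : ℕ → ℕ} (t-terminal : Terminal t) (odoU : Odometer c₀ t U) where

  -- If v i = U i, comparing the two conservation equations at i gives c i ≤ t i < 3.
  unstable-below-odometer : ∀ {c v i} → Odometer c₀ c v → (∀ x → v x ≤ U x) → 1 ≤ i → 3 ≤ c i → v i < U i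
  unstable-below-odometer {c} {v} {i} odo v≤U i≥1 3≤ci with m≤n⇒m<n∨m≡n (v≤U i)
  ... | inj₁ vi<Ui = vi<Ui
  ... | inj₂ vi≡Ui = ⊥-elim (<⇒≱ (t-terminal i i≥1) (≤-trans 3≤ci ci≤ti))
    where
    open ≤-Reasoning
    ci≤ti : c i ≤ t i
    ci≤ti = +-cancelʳ-≤ (3 * U i) (c i) (t i) (begin
      c i + 3 * U i       ≡⟨ cong (λ x → c i + 3 * x) (sym vi≡Ui) ⟩
      c i + 3 * v i       ≡⟨ odo i i≥1 ⟩
      c₀ i + inflow v i   ≤⟨ +-monoʳ-≤ (c₀ i) (inflow-mono v≤U i) ⟩
      c₀ i + inflow U i   ≡⟨ odoU i i≥1 ⟨
      t i + 3 * U i       ∎)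

  least-action : ∀ {c c′ v} → Reachable c c′ → Odometer c₀ c v → (∀ x → v x ≤ U x) →
    ∃ λ u → Odometer c₀ c′ u × (∀ x → u x ≤ U x)
  least-action ε odo v≤U = _ , odo , v≤U
  least-action {c} {v = v} (s@(i , i≥1 , 3≤ci , _) ◅ steps) odo v≤U =
    least-action steps (odometer-step {c₀} {c} {v = v} odo s) v+δ≤U
    where
    v+δ≤U : ∀ x → v x + ind x i ≤ U x
    v+δ≤U x with x ≟ i
    ... | yes refl rewrite ind-refl x = subst (_≤ U x) (+-comm 1 (v x)) (unstable-below-odometer {c} odo v≤U i≥1 3≤ci)
    ... | no x≢i   rewrite ind-≢ x≢i  = subst (_≤ U x) (sym (+-identityʳ (v x))) (v≤U x)

excess-rises : ∀ {t c x p a b} → t + 3 * x ≡ c + (p + a + b) → 1 ≤ t → c ≤ 2 → a < x → b < x → x < p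
excess-rises {t} {c} {x} {p} {a} {b} conservation 1≤t c≤2 a<x b<x = +-cancelʳ-≤ (x + x) (suc x) p (begin
  suc x + (x + x)     ≡⟨ cong suc (triple x) ⟩
  1 + 3 * x           ≤⟨ +-monoˡ-≤ (3 * x) 1≤t ⟩
  t + 3 * x           ≡⟨ conservation ⟩
  c + (p + a + b)     ≤⟨ +-monoˡ-≤ (p + a + b) c≤2 ⟩
  2 + (p + a + b)     ≡⟨ two-units p a b ⟩
  p + suc a + suc b   ≤⟨ +-mono-≤ (+-monoʳ-≤ p a<x) b<x ⟩
  p + x + x           ≡⟨ +-assoc p x x ⟩
  p + (x + x)         ∎)
  where
  open ≤-Reasoning
  triple : ∀ x → x + (x + x) ≡ 3 * x
  triple = solve-∀
  two-units : ∀ p a b → 2 + (p + a + b) ≡ p + suc a + suc b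
  two-units = solve-∀

module _ {n : ℕ} {c t w : Config} (odo : Odometer c t w) (c-terminal : Terminal c)
         (t-occupied : ∀ j → 1 ≤ j → ⌊log₂ j ⌋ < n → 1 ≤ t j)
         (w-deep : ∀ j → n ≤ ⌊log₂ j ⌋ → w j ≡ 0) where

  below-parent : ∀ k j → 1 ≤ j → n ≤ k + ⌊log₂ j ⌋ → w j ≡ 0 ⊎ w j < w (parent j)
  below-parent zero    j _   deep = inj₁ (w-deep j deep)
  below-parent (suc k) j j≥1 n≤k+1+d with n ≤? ⌊log₂ j ⌋
  ... | yes deep = inj₁ (w-deep j deep)
  ... | no shallow with w j ≟ 0
  ...   | yes wj≡0 = inj₁ wj≡0
  ...   | no wj≢0  = inj₂ (excess-rises (odo j j≥1) (t-occupied j j≥1 (≰⇒> shallow))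
                                  (s≤s⁻¹ (c-terminal j j≥1)) (child-below (parent-left j≥1) (depth-left j≥1) (left-positive j≥1))
                                  (child-below (parent-right j≥1) (depth-right j≥1) (right-positive j≥1)))
    where
    0<wj : 0 < w j
    0<wj = n≢0⇒n>0 wj≢0
    child-below : ∀ {a} → parent a ≡ j → ⌊log₂ a ⌋ ≡ suc ⌊log₂ j ⌋ → 1 ≤ a → w a < w j
    child-below {a} parent≡j depth a≥1
      with below-parent k a a≥1 (subst (n ≤_) (sym (trans (cong (k +_) depth) (+-suc k _))) n≤k+1+d)
    ... | inj₁ wa≡0 = subst (_< w j) (sym wa≡0) 0<wj
    ... | inj₂ wa<wp = subst (λ x → w a < w x) parent≡j wa<wp

  odometer-vanishes : ∀ j → 1 ≤ j → w j ≡ 0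
  odometer-vanishes j j≥1 = at-depth ⌊log₂ j ⌋ j j≥1 refl
    where
    below : ∀ j → 1 ≤ j → w j ≡ 0 ⊎ w j < w (parent j)
    below j j≥1 = below-parent n j j≥1 (m≤m+n n _)
    at-depth : ∀ d j → 1 ≤ j → ⌊log₂ j ⌋ ≡ d → w j ≡ 0
    -- The self-loop makes the root its own parent.
    at-depth _       (suc zero)      _   _ with below 1 (s≤s z≤n)
    ... | inj₁ w1≡0 = w1≡0
    ... | inj₂ w1<w1 = ⊥-elim (<-irrefl refl w1<w1)
    at-depth zero    j@(suc (suc _)) _   d≡0 = ⊥-elim (1+n≢0 (trans (sym (depth-parent {j} (s≤s (s≤s z≤n)))) d≡0))
    at-depth (suc d) j@(suc (suc _)) j≥1 d≡1+d with below j j≥1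
    ... | inj₁ wj≡0 = wj≡0
    ... | inj₂ wj<wp = ⊥-elim (n≮0 (subst (w j <_) wp≡0 wj<wp))
      where
      wp≡0 : w (parent j) ≡ 0
      wp≡0 = at-depth d (parent j) (parent-positive j≥1)
               (suc-injective (trans (sym (depth-parent {j} (s≤s (s≤s z≤n)))) d≡1+d))

-- The level profile

balance : ∀ {a s r g f i p} → s ≡ a + 2 * r → g ≡ r + f → i + p ≡ s + g → a + 3 * g ≡ i + (p + f + f)
balance {a} {s} {r} {g} {f} {i} {p} s≡a+2r g≡r+f arrival = begin
  a + 3 * g                        ≡⟨ cong (λ x → a + 3 * x) g≡r+f ⟩
  a + 3 * (r + f)                  ≡⟨ regroup a r f ⟩
  (a + 2 * r) + (r + f) + (f + f)  ≡⟨ cong₂ (λ x y → x + y + (f + f)) s≡a+2r g≡r+f ⟨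
  s + g + (f + f)                  ≡⟨ cong (_+ (f + f)) arrival ⟨
  i + p + (f + f)                  ≡⟨ assoc i p f ⟩
  i + (p + f + f)                  ∎
  where
  open ≡-Reasoning
  regroup : ∀ a r f → a + 3 * (r + f) ≡ (a + 2 * r) + (r + f) + (f + f)
  regroup = solve-∀
  assoc : ∀ i p f → i + p + (f + f) ≡ i + (p + f + f)
  assoc = solve-∀

module Profile (N : ℕ) where

  height : ℕ
  height = ⌊log₂ suc N ⌋

  -- carry l = ⌊(N + 1) / 2 ^ l⌋; subtree l chips end up in the subtree of each node of depth l.
  carry : ℕ → ℕ
  carry zero    = suc N
  carry (suc l) = ⌊ carry l /2⌋

  subtree : ℕ → ℕ
  subtree l = carry l ∸ 1

  chips : ℕ → ℕ
  chips l = subtree l ∸ 2 * subtree (suc l)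

  subtree-sum : ℕ → ℕ → ℕ
  subtree-sum s zero    = 0
  subtree-sum s (suc k) = subtree s + subtree-sum (suc s) k

  -- firings l − firings (l + 1) is the net flow into a child subtree, i.e. subtree (l + 1).
  firings : ℕ → ℕ
  firings l = subtree-sum (suc l) (height ∸ suc l)

  profile : Config
  profile j = chips ⌊log₂ j ⌋

  profile-firings : ℕ → ℕ
  profile-firings j = firings ⌊log₂ j ⌋

  ⌊log₂⌋-carry : ∀ l → ⌊log₂ carry l ⌋ ≡ height ∸ l
  ⌊log₂⌋-carry zero    = refl
  ⌊log₂⌋-carry (suc l) = begin
    ⌊log₂ ⌊ carry l /2⌋ ⌋   ≡⟨ ⌊log₂⌊n/2⌋⌋≡⌊log₂n⌋∸1 (carry l) ⟩
    ⌊log₂ carry l ⌋ ∸ 1     ≡⟨ cong (_∸ 1) (⌊log₂⌋-carry l) ⟩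
    height ∸ l ∸ 1          ≡⟨ ∸-+-assoc height l 1 ⟩
    height ∸ (l + 1)        ≡⟨ cong (height ∸_) (+-comm l 1) ⟩
    height ∸ suc l          ∎
    where open ≡-Reasoning

  carry≤1 : ∀ {l} → height ≤ l → carry l ≤ 1
  carry≤1 {l} height≤l = ≮⇒≥ λ 2≤carry → 1+n≰n (subst (1 ≤_) depth≡0 (⌊log₂⌋-positive 2≤carry))
    where
    depth≡0 : ⌊log₂ carry l ⌋ ≡ 0
    depth≡0 = trans (⌊log₂⌋-carry l) (m≤n⇒m∸n≡0 height≤l)

  2≤carry : ∀ {l} → l < height → 2 ≤ carry l
  2≤carry {l} l<height = ⌊log₂⌋-positive⁻¹ (subst (1 ≤_) (sym (⌊log₂⌋-carry l)) (m<n⇒0<n∸m l<height))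

  subtree-split : ∀ l → subtree l ≡ chips l + 2 * subtree (suc l)
  subtree-split l with carry l
  ... | zero        = refl
  ... | suc zero    = refl
  ... | suc (suc m) = sym (m∸n+n≡m (≤-trans (2*⌊n/2⌋≤n m) (n≤1+n m)))

  private
    suc∸2*⌊/2⌋ : ∀ m → suc m ∸ 2 * ⌊ m /2⌋ ≡ suc (m ∸ 2 * ⌊ m /2⌋)
    suc∸2*⌊/2⌋ m = +-∸-assoc 1 (2*⌊n/2⌋≤n m)

  chips≤2 : ∀ l → chips l ≤ 2
  chips≤2 l with carry l
  ... | zero        = z≤n
  ... | suc zero    = z≤n
  ... | suc (suc m) = subst (_≤ 2) (sym (suc∸2*⌊/2⌋ m)) (s≤s (n∸2*⌊n/2⌋≤1 m))

  chips-positive : ∀ {l} → l < height → 1 ≤ chips l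
  chips-positive {l} l<height with carry l | 2≤carry l<height
  ... | suc zero    | s≤s ()
  ... | suc (suc m) | _ = subst (1 ≤_) (sym (suc∸2*⌊/2⌋ m)) (s≤s z≤n)

  subtree-deep : ∀ {l} → height ≤ l → subtree l ≡ 0
  subtree-deep height≤l = m≤n⇒m∸n≡0 (carry≤1 height≤l)

  chips-deep : ∀ {l} → height ≤ l → chips l ≡ 0
  chips-deep {l} height≤l = trans (cong (_∸ 2 * subtree (suc l)) (subtree-deep height≤l)) (0∸n≡0 (2 * subtree (suc l)))

  firings-deep : ∀ {l} → height ≤ l → firings l ≡ 0
  firings-deep height≤l = cong (subtree-sum _) (m≤n⇒m∸n≡0 (m≤n⇒m≤1+n height≤l))

  firings-step : ∀ l → firings l ≡ subtree (suc l) + firings (suc l)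
  firings-step l with height ∸ suc l in eq
  ... | suc k = cong (λ k → subtree (suc l) + subtree-sum (suc (suc l)) k)
                  (trans (cong pred (sym eq)) (pred[m∸n]≡m∸[1+n] height (suc l)))
  ... | zero  = sym (cong₂ _+_ (subtree-deep height≤1+l) (firings-deep height≤1+l))
    where
    height≤1+l : height ≤ suc l
    height≤1+l = m∸n≡0⇒m≤n eq

  arrival : ∀ j → 1 ≤ j → initial N j + firings ⌊log₂ parent j ⌋ ≡ subtree ⌊log₂ j ⌋ + firings ⌊log₂ j ⌋
  arrival (suc zero)        _ = refl
  arrival j@(suc (suc _)) _ = trans (firings-step ⌊log₂ parent j ⌋)
    (cong (λ d → subtree d + firings d) (sym (depth-parent {j} (s≤s (s≤s z≤n)))))

  profile-odometer : Odometer (initial N) profile profile-firings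
  profile-odometer j j≥1 rewrite depth-left j≥1 | depth-right j≥1 =
    balance {chips d} {r = subtree (suc d)} {f = firings (suc d)} {initial N j} {firings ⌊log₂ parent j ⌋}
      (subtree-split d) (firings-step d) (arrival j j≥1)
    where d = ⌊log₂ j ⌋

  profile-terminal : Terminal profile
  profile-terminal j _ = s≤s (chips≤2 ⌊log₂ j ⌋)

  terminal-is-profile : ∀ {c} → Reachable (initial N) c → Terminal c → ∀ j → 1 ≤ j → c j ≡ profile j
  terminal-is-profile {c} reach c-terminal j j≥1
    with least-action profile-terminal profile-odometer {v = λ _ → 0} reach (odometer-refl (initial N)) (λ _ → z≤n)
  ... | u , odo , u≤U = sym (odometer-zero {c} {profile} excess
                              (odometer-vanishes {height} excess c-terminal (λ i _ → chips-positive) excess-deep) j j≥1)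
    where
    excess : Odometer c profile (λ x → profile-firings x ∸ u x)
    excess = odometer-difference {initial N} {c} {profile} odo profile-odometer u≤U
    excess-deep : ∀ i → height ≤ ⌊log₂ i ⌋ → profile-firings i ∸ u i ≡ 0
    excess-deep i deep = trans (cong (_∸ u i) (firings-deep deep)) (0∸n≡0 (u i))

proposition3p3 : (n N : ℕ) → 1 ≤ n → 2 ^ n ∸ 1 ≤ N → N ≤ 2 ^ (suc n) ∸ 2 →
    (c : Config) → Reachable (initial N) c → Terminal c →
      ((i : ℕ) → 1 ≤ i → ((1 ≤ c i → level i ≤ n) × (level i ≤ n → 1 ≤ c i)))
      × ((i j : ℕ) → 1 ≤ i → 1 ≤ j → level i ≡ level j → c i ≡ c j)
proposition3p3 n N _ lo hi c reach c-terminal = occupied , level-uniform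
  where
  open Profile N
  height≡n : height ≡ n
  height≡n = ⌊log₂⌋-between n (≤-trans (m≤n+m∸n (2 ^ n) 1) (s≤s lo))
    (≤-trans (s≤s (s≤s hi)) (≤-reflexive (m+[n∸m]≡n (*-monoʳ-≤ 2 (m^n>0 2 n)))))
  c≡profile : ∀ i → 1 ≤ i → c i ≡ chips ⌊log₂ i ⌋
  c≡profile = terminal-is-profile reach c-terminal
  occupied : (i : ℕ) → 1 ≤ i → ((1 ≤ c i → level i ≤ n) × (level i ≤ n → 1 ≤ c i))
  occupied i i≥1 =
    (λ 1≤ci → ≰⇒> λ n≤d → 1+n≰n (subst (1 ≤_) (trans (c≡profile i i≥1) (chips-deep (subst (_≤ _) (sym height≡n) n≤d))) 1≤ci)) ,
    (λ d<n → subst (1 ≤_) (sym (c≡profile i i≥1)) (chips-positive (subst (_ <_) (sym height≡n) d<n)))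
  level-uniform : (i j : ℕ) → 1 ≤ i → 1 ≤ j → level i ≡ level j → c i ≡ c j
  level-uniform i j i≥1 j≥1 same-level =
    trans (c≡profile i i≥1) (trans (cong chips (suc-injective same-level)) (sym (c≡profile j j≥1)))
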